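{- Let $X$ be a connected graph without loops and multiple edges. There exists a continuous surjection $f$ from $(VX\cup\Omega_{\mathrm{V}}X,\tau_{\mathrm{V}}X)$ onto $(VX\cup\Omega_{\mathrm{E}}X,\tau_{\mathrm{E}}X)$ whose restriction to $VX$ is the identity.
   Context: For $e\subseteq VX$, $e^{*}=VX\setminus e$, $\theta e$ is the set of vertices of $e^{*}$ adjacent to a vertex of $e$, $\delta e$ is the set of edges between $e$ and $e^{*}$. A vertex-cut (edge-cut) is a nonempty $e$ with $\theta e$ ($\delta e$) finite. A ray is a sequence of pairwise distinct vertices with consecutive ones adjacent; it lies in $e$ if all but finitely many of its vertices are in $e$; $e$ separates two rays if one lies in $e$, the other in $e^{*}$. Rays are vertex-equivalent (edge-equivalent) if no vertex-cut (edge-cut) separates them; the classes are vertex-ends (edge-ends). An end lies in $e$ if all its rays lie in $e$; $\Omega_{\mathrm{V}}e$, $\Omega_{\mathrm{E}}e$ are the sets of vertex-, resp. edge-ends lying in $e$; $\Omega_{\mathrm{V}}X=\Omega_{\mathrm{V}}VX$, $\Omega_{\mathrm{E}}X=\Omega_{\mathrm{E}}VX$. $\tau_{\mathrm{V}}X$ is generated by $\{e\cup\Omega_{\mathrm{V}}e\mid |\theta e|<\infty\}$ and $\tau_{\mathrm{E}}X$ by $\{e\cup\Omega_{\mathrm{E}}e\mid |\delta e|<\infty\}$ ($e\subseteq VX$). -}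

module Defs where

open import Level using (0ℓ; Lift)
open import Data.Empty using (⊥)
open import Data.Nat using (ℕ; suc; _≥_)
open import Data.Product using (Σ; ∃; _×_; _,_; proj₁)
open import Data.Sum using (_⊎_; inj₁; inj₂)
open import Data.List using (List; []; _∷_)
open import Data.List.Membership.Propositional using (_∈_)
open import Data.List.Relation.Unary.All using (All)
open import Relation.Nullary using (¬_)
open import Relation.Unary using (Pred)
open import Relation.Binary.PropositionalEquality using (_≡_)

Finite : {A : Set} → Pred A 0ℓ → Set
Finite {A} P = Σ (List A) λ l → ∀ a → P a → a ∈ l

-- A graph without loops and multiple edges: a symmetric irreflexive
-- adjacency relation on a vertex type (edges are unordered pairs of vertices).
record Graph : Set₁ where
  field
    V      : Set
    Adj    : V → V → Set
    sym    : ∀ {u v} → Adj u v → Adj v u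
    irrefl : ∀ {v} → ¬ Adj v v

module _ (X : Graph) where
  open Graph X

  data Walk : V → V → Set where
    here : ∀ {v} → Walk v v
    step : ∀ {u v w} → Adj u v → Walk v w → Walk u w

  Connected : Set
  Connected = ∀ u v → Walk u v

  comp : Pred V 0ℓ → Pred V 0ℓ
  comp e v = ¬ e v

  θ : Pred V 0ℓ → Pred V 0ℓ
  θ e v = comp e v × Σ V λ u → e u × Adj u v

  δ : Pred V 0ℓ → Pred (V × V) 0ℓ
  δ e (u , v) = e u × comp e v × Adj u v

  NonEmpty : Pred V 0ℓ → Set
  NonEmpty e = Σ V e

  VertexCut : Pred V 0ℓ → Set
  VertexCut e = NonEmpty e × Finite (θ e)

  EdgeCut : Pred V 0ℓ → Set
  EdgeCut e = NonEmpty e × Finite (δ e)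

  record Ray : Set where
    field
      seq  : ℕ → V
      inj  : ∀ m n → seq m ≡ seq n → m ≡ n
      adj  : ∀ n → Adj (seq n) (seq (suc n))
  open Ray public

  LiesIn : Ray → Pred V 0ℓ → Set
  LiesIn r e = Σ ℕ λ N → ∀ n → n ≥ N → e (seq r n)

  Separates : Pred V 0ℓ → Ray → Ray → Set
  Separates e r s = (LiesIn r e × LiesIn s (comp e)) ⊎ (LiesIn s e × LiesIn r (comp e))

  VEquiv : Ray → Ray → Set₁
  VEquiv r s = ¬ (Σ (Pred V 0ℓ) λ e → VertexCut e × Separates e r s)

  EEquiv : Ray → Ray → Set₁
  EEquiv r s = ¬ (Σ (Pred V 0ℓ) λ e → EdgeCut e × Separates e r s)

  -- the end of r lies in e (all rays of its class lie in e);
  -- ends are represented by rays up to the respective equivalence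
  ΩV : Pred V 0ℓ → Ray → Set₁
  ΩV e r = ∀ s → VEquiv r s → LiesIn s e

  ΩE : Pred V 0ℓ → Ray → Set₁
  ΩE e r = ∀ s → EEquiv r s → LiesIn s e

  -- points of VX ∪ ΩX : vertices or rays (rays taken up to end-equivalence)
  Point : Set
  Point = V ⊎ Ray

  _≈V_ : Point → Point → Set₁
  inj₁ u ≈V inj₁ v = Lift _ (u ≡ v)
  inj₂ r ≈V inj₂ s = VEquiv r s
  _      ≈V _      = Lift _ ⊥

  _≈E_ : Point → Point → Set₁
  inj₁ u ≈E inj₁ v = Lift _ (u ≡ v)
  inj₂ r ≈E inj₂ s = EEquiv r s
  _      ≈E _      = Lift _ ⊥

  BV : Pred V 0ℓ → Point → Set₁
  BV e (inj₁ v) = Lift _ (e v)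
  BV e (inj₂ r) = ΩV e r

  BE : Pred V 0ℓ → Point → Set₁
  BE e (inj₁ v) = Lift _ (e v)
  BE e (inj₂ r) = ΩE e r

  GenOpen : (C : Pred V 0ℓ → Set) → (Pred V 0ℓ → Point → Set₁) →
            (Point → Set₁) → Set₁
  GenOpen C B U = ∀ x → U x →
    Σ (List (Σ (Pred V 0ℓ) C)) λ es →
      All (λ ec → B (proj₁ ec) x) es ×
      (∀ y → All (λ ec → B (proj₁ ec) y) es → U y)

  OpenV : (Point → Set₁) → Set₁
  OpenV = GenOpen (λ e → Finite (θ e)) BV

  OpenE : (Point → Set₁) → Set₁
  OpenE = GenOpen (λ e → Finite (δ e)) BE

  Continuous : (Point → Point) → Set₂
  Continuous f = ∀ (U : Point → Set₁) → OpenE U → OpenV (λ x → U (f x))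

  WellDefined : (Point → Point) → Set₁
  WellDefined f = ∀ x y → x ≈V y → f x ≈E f y

  Surjective : (Point → Point) → Set₁
  Surjective f = ∀ y → Σ Point λ x → f x ≈E y

  IdOnVertices : (Point → Point) → Set
  IdOnVertices f = ∀ v → f (inj₁ v) ≡ inj₁ v

-- classical excluded middle (the paper's ambient logic)
ExcludedMiddle : Set₁
ExcludedMiddle = (P : Set) → P ⊎ ¬ P

-- Ends are represented by rays, and every edge-cut is a vertex-cut, so rays that no
-- vertex-cut separates are not separated by an edge-cut either: the identity map is
-- well defined from vertex-ends to edge-ends and is onto. For continuity, a subbasic
-- set e ∪ Ω_E e is also open in τ_V: it is e ∪ Ω_V e. The inclusion Ω_E e ⊆ Ω_V e is
-- immediate; conversely, a ray eventually avoids the finitely many edges of δ e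
-- (rays are injective), so it ends up in e or in e*, and if it ends up in e* while
-- some vertex-equivalent ray lies in e, then e is an edge-cut separating them.
module Submission where

open import Defs
open import Level using (lift)
open import Data.Empty using (⊥; ⊥-elim)
open import Data.Nat using (ℕ; suc; _≥_; _≤′_; ≤′-refl; ≤′-step; _⊔_; _+_)
open import Data.Nat.Properties
  using (≤⇒≤′; ≤′⇒≤; ≤-trans; ≤-refl; m≤m⊔n; m≤n⊔m; m≤m+n; m≤n+m; m≤n⇒m≤1+n; <-irrefl)
open import Data.Product using (Σ; _×_; _,_; proj₁; proj₂)
open import Data.Sum using (_⊎_; inj₁; inj₂)
open import Data.List using (List; []; _∷_; map)
open import Data.List.Membership.Propositional using (_∉_)
open import Data.List.Membership.Propositional.Properties using (∈-map⁺)
open import Data.List.Relation.Unary.All as All using (All)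
open import Data.List.Relation.Unary.All.Properties using (map⁺; map⁻)
open import Data.List.Relation.Unary.Any using (here; there)
open import Relation.Unary using (Pred)
open import Relation.Binary.PropositionalEquality using (_≡_; refl; sym; trans)

eventually-invariant : ∀ {ℓ} (P : Pred ℕ ℓ) {N : ℕ} →
  (∀ n → n ≥ N → P n → P (suc n)) → P N → ∀ n → n ≥ N → P n
eventually-invariant P {N} preserved pN n n≥N = go (≤⇒≤′ n≥N)
  where
  go : ∀ {n} → N ≤′ n → P n
  go ≤′-refl = pN
  go (≤′-step N≤′n) = preserved _ (≤′⇒≤ N≤′n) (go N≤′n)

injective-eventually-∉ : ExcludedMiddle → {A : Set} (f : ℕ → A) →
  (∀ m n → f m ≡ f n → m ≡ n) → (l : List A) → Σ ℕ λ N → ∀ n → n ≥ N → f n ∉ l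
injective-eventually-∉ lem f f-inj [] = 0 , λ _ _ ()
injective-eventually-∉ lem f f-inj (a ∷ l)
  with lem (Σ ℕ λ m → f m ≡ a) | injective-eventually-∉ lem f f-inj l
... | inj₁ (m , fm≡a) | N , avoid = suc m ⊔ N , λ where
  n n≥ (here fn≡a)  → <-irrefl (f-inj m n (trans fm≡a (sym fn≡a)))
                               (≤-trans (m≤m⊔n (suc m) N) n≥)
  n n≥ (there n∈l) → avoid n (≤-trans (m≤n⊔m (suc m) N) n≥) n∈l
... | inj₂ ¬hit | N , avoid = N , λ where
  n n≥ (here fn≡a)  → ¬hit (n , fn≡a)
  n n≥ (there n∈l) → avoid n n≥ n∈l

module _ (X : Graph) where
  open Graph X using (V)

  δ-finite⇒θ-finite : ∀ {e} → Finite (δ X e) → Finite (θ X e)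
  δ-finite⇒θ-finite (l , cover) =
    map proj₂ l , λ { v (v∉e , u , u∈e , u~v) → ∈-map⁺ _ (cover (u , v) (u∈e , v∉e , u~v)) }

  edgeCut⇒vertexCut : ∀ {e} → EdgeCut X e → VertexCut X e
  edgeCut⇒vertexCut (nonempty , finite) = nonempty , δ-finite⇒θ-finite finite

  vEquiv⇒eEquiv : ∀ r s → VEquiv X r s → EEquiv X r s
  vEquiv⇒eEquiv r s r~s (e , cut , sep) = r~s (e , edgeCut⇒vertexCut cut , sep)

  ¬liesIn-both : ∀ r e → LiesIn X r e → LiesIn X r (comp X e) → ⊥
  ¬liesIn-both r e (N , in-e) (M , in-e*) = in-e* (N + M) (m≤n+m M N) (in-e (N + M) (m≤m+n N M))

  ¬separates-self : ∀ e r → Separates X e r r → ⊥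
  ¬separates-self e r (inj₁ (in-e , in-e*)) = ¬liesIn-both r e in-e in-e*
  ¬separates-self e r (inj₂ (in-e , in-e*)) = ¬liesIn-both r e in-e in-e*

  vEquiv-refl : ∀ r → VEquiv X r r
  vEquiv-refl r (e , _ , sep) = ¬separates-self e r sep

  ≈E-refl : ∀ x → _≈E_ X x x
  ≈E-refl (inj₁ v) = lift refl
  ≈E-refl (inj₂ r) (e , _ , sep) = ¬separates-self e r sep

  liesIn-⊎ : ExcludedMiddle → (s : Ray X) {e : Pred V _} → Finite (δ X e) →
    LiesIn X s e ⊎ LiesIn X s (comp X e)
  liesIn-⊎ lem s {e} (l , cover) with injective-eventually-∉ lem (seq s) (inj s) (map proj₁ l)
  ... | N , avoid with lem (e (seq s N))
  ...   | inj₁ sN∈e  = inj₁ (N , eventually-invariant (λ n → e (seq s n)) stays-in sN∈e)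
    where
    stays-in : ∀ n → n ≥ N → e (seq s n) → e (seq s (suc n))
    stays-in n n≥N sn∈e with lem (e (seq s (suc n)))
    ... | inj₁ sn+1∈e = sn+1∈e
    ... | inj₂ sn+1∉e = ⊥-elim (avoid n n≥N (∈-map⁺ proj₁ (cover _ (sn∈e , sn+1∉e , adj s n))))
  ...   | inj₂ sN∉e = inj₂ (N , eventually-invariant (λ n → comp X e (seq s n)) stays-out sN∉e)
    where
    stays-out : ∀ n → n ≥ N → comp X e (seq s n) → comp X e (seq s (suc n))
    stays-out n n≥N sn∉e sn+1∈e =
      avoid (suc n) (m≤n⇒m≤1+n n≥N)
        (∈-map⁺ proj₁ (cover _ (sn+1∈e , sn∉e , Graph.sym X (adj s n))))

  BE⇒BV : ∀ e x → BE X e x → BV X e x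
  BE⇒BV e (inj₁ v) v∈e = v∈e
  BE⇒BV e (inj₂ r) r∈Ωe s r~s = r∈Ωe s (vEquiv⇒eEquiv r s r~s)

  BV⇒BE : ExcludedMiddle → ∀ e → Finite (δ X e) → ∀ x → BV X e x → BE X e x
  BV⇒BE lem e finite (inj₁ v) v∈e = v∈e
  BV⇒BE lem e finite (inj₂ r) r∈Ωe s r~s with liesIn-⊎ lem s finite
  ... | inj₁ s∈e  = s∈e
  ... | inj₂ s∈e* = ⊥-elim (r~s (e , ((seq r N , r∈e N ≤-refl) , finite) , inj₁ ((N , r∈e) , s∈e*)))
    where
    N = proj₁ (r∈Ωe r (vEquiv-refl r))
    r∈e = proj₂ (r∈Ωe r (vEquiv-refl r))

  asVertexCut : Σ (Pred V _) (λ e → Finite (δ X e)) → Σ (Pred V _) (λ e → Finite (θ X e))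
  asVertexCut (e , finite) = e , δ-finite⇒θ-finite finite

  id-continuous : ExcludedMiddle → Continuous X (λ x → x)
  id-continuous lem U U-open x x∈U with U-open x x∈U
  ... | cuts , x∈⋂ , ⋂⊆U =
    map asVertexCut cuts ,
    map⁺ (All.map (λ {(e , _)} → BE⇒BV e x) x∈⋂) ,
    λ y y∈⋂ → ⋂⊆U y (All.map (λ {(e , finite)} → BV⇒BE lem e finite y) (map⁻ y∈⋂))

  id-wellDefined : WellDefined X (λ x → x)
  id-wellDefined (inj₁ u) (inj₁ v) u≡v = u≡v
  id-wellDefined (inj₁ u) (inj₂ s) ()
  id-wellDefined (inj₂ r) (inj₁ v) ()
  id-wellDefined (inj₂ r) (inj₂ s) r~s = vEquiv⇒eEquiv r s r~s

lemma7 : ExcludedMiddle → (X : Graph) → Connected X →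
    Σ (Point X → Point X) λ f →
      WellDefined X f × Continuous X f × Surjective X f × IdOnVertices X f
lemma7 lem X _ =
  (λ x → x) ,
  id-wellDefined X ,
  id-continuous X lem ,
  (λ y → y , ≈E-refl X y) ,
  (λ v → refl)
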